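{- Fix $n\ge 3$. For $\mathbf{a}\in\mathbb{Z}^{n-3}$ write $s(\mathbf{a})=\sum_i a_i$ and $\|\mathbf{a}\|^2=\sum_i a_i^2$, and for an integer $m\ge 0$ put $J(\mathbf{a},m)=m^2+m+1+2\left(s(\mathbf{a})^2+s(\mathbf{a})+\|\mathbf{a}\|^2\right)$. For any $\mathbf{a}\in\mathbb{Z}^{n-3}$, any $m\ge 0$ and any integers $0\le b\le c$ with $J(\mathbf{a},m)=(2b+1)(2c+1)$, the following four $n$-tuples are integer solutions of $$F_n(x_1,\dots,x_n):=\Big(\sum_{i=1}^n x_i\Big)^2-\sum_{i=1}^n x_i-4\sum_{1\le i<j\le n}x_ix_j=0:$$ $$(b-s(\mathbf{a}),\ c-s(\mathbf{a}),\ b+c+1-s(\mathbf{a})+m,\ \mathbf{a}),$$ $$(b-s(\mathbf{a}),\ c-s(\mathbf{a}),\ b+c-s(\mathbf{a})-m,\ \mathbf{a}),$$ $$(-(c+1)-s(\mathbf{a}),\ -(b+1)-s(\mathbf{a}),\ -(b+c+s(\mathbf{a})+1)+m,\ \mathbf{a}),$$ $$(-(c+1)-s(\mathbf{a}),\ -(b+1)-s(\mathbf{a}),\ -(b+c+s(\mathbf{a})+2)-m,\ \mathbf{a}).$$ Moreover, up to a permutation of coordinates, every integer solution of $F_n=0$ is of one of these four forms for some such $\mathbf{a},m,b,c$.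
   Context: When $n=3$, $\mathbf{a}$ is the empty tuple, with $s(\mathbf{a})=0$ and $\|\mathbf{a}\|^2=0$. In the displayed tuples, "$\mathbf{a}$" in the last position means the $n-3$ coordinates of $\mathbf{a}$ are appended. -}

module Defs where

open import Data.Integer using (ℤ; +_; _+_; _-_; _*_; -_; _≤_)
open import Data.List using (List; []; _∷_)
open import Data.Vec using (Vec; toList)
open import Data.Nat using (ℕ)

sumℤ : List ℤ → ℤ
sumℤ [] = + 0
sumℤ (x ∷ xs) = x + sumℤ xs

sqSum : List ℤ → ℤ
sqSum [] = + 0
sqSum (x ∷ xs) = x * x + sqSum xs

pairSum : List ℤ → ℤ
pairSum [] = + 0
pairSum (x ∷ xs) = x * sumℤ xs + pairSum xs

F : List ℤ → ℤ
F xs = sumℤ xs * sumℤ xs - sumℤ xs - + 4 * pairSum xs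

s : ∀ {k} → Vec ℤ k → ℤ
s a = sumℤ (toList a)

norm2 : ∀ {k} → Vec ℤ k → ℤ
norm2 a = sqSum (toList a)

J : ∀ {k} → Vec ℤ k → ℤ → ℤ
J a m = m * m + m + + 1 + + 2 * (s a * s a + s a + norm2 a)

tuple₁ tuple₂ tuple₃ tuple₄ : ∀ {k} → Vec ℤ k → ℤ → ℤ → ℤ → List ℤ
tuple₁ a m b c = (b - s a) ∷ (c - s a) ∷ (b + c + + 1 - s a + m) ∷ toList a
tuple₂ a m b c = (b - s a) ∷ (c - s a) ∷ (b + c - s a - m) ∷ toList a
tuple₃ a m b c = (- (c + + 1) - s a) ∷ (- (b + + 1) - s a) ∷ (- (b + c + s a + + 1) + m) ∷ toList a
tuple₄ a m b c = (- (c + + 1) - s a) ∷ (- (b + + 1) - s a) ∷ (- (b + c + s a + + 2) - m) ∷ toList a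

Admissible : ∀ {k} → Vec ℤ k → ℤ → ℤ → ℤ → Set
Admissible a m b c =
  (+ 0 ≤ m) × (+ 0 ≤ b) × (b ≤ c) × (J a m ≡ (+ 2 * b + + 1) * (+ 2 * c + + 1))
  where
  open import Data.Product using (_×_)
  open import Relation.Binary.PropositionalEquality using (_≡_)

-- Since 2 Σ_{i<j} x_i x_j = (Σ x_i)² − Σ x_i², F depends only on the sum and the sum of
-- squares, and on (b − s, c − s, b + c + 1 − s + m, a), with s = s(a), it equals
-- J(a,m) − (2b+1)(2c+1).  Every tuple has this shape, with b = x₁ + s and c = x₂ + s, so the
-- solutions are exactly these tuples with J(a,m) = (2b+1)(2c+1).  The symmetries m ↦ −m−1 of J
-- and (b,c) ↦ (−c−1,−b−1) of (2b+1)(2c+1) produce the other three families and let us assume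
-- m ≥ 0 and 0 ≤ b ≤ c (after swapping x₁, x₂): the case b < 0 ≤ c cannot occur, because
-- J > 0 whereas (2b+1)(2c+1) < 0.
module Submission where

open import Defs
open import Data.Nat using (ℕ; suc; _∸_; z≤n; s≤s)
open import Data.Integer
  using (ℤ; +_; -[1+_]; _+_; _-_; _*_; -_; _≤_; _<_; +≤+; +<+)
open import Data.Integer.Properties
  using (*-distribˡ-+; *-assoc; *-monoˡ-≤-nonNeg; *-zeroʳ; neg-mono-≤; +-monoˡ-≤; _≤?_; ≰⇒>; <⇒≤;
         <⇒≱; i≡j⇒i-j≡0; i-j≡0⇒i≡j)
open import Data.Integer.Tactic.RingSolver using (solve-∀)
open import Data.Vec using (Vec; toList; _∷_)
open import Data.List using (List; []; _∷_)
open import Data.Product using (_×_; ∃-syntax; _,_)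
open import Data.Sum using (_⊎_; inj₁; inj₂)
import Data.Sum as Sum
open import Data.Empty using (⊥-elim)
open import Relation.Nullary using (Dec; yes; no; ¬_)
open import Relation.Binary.PropositionalEquality
  using (_≡_; _≢_; refl; sym; trans; cong; cong₂; subst; module ≡-Reasoning)
open import Data.List.Relation.Binary.Permutation.Propositional
  using (_↭_; ↭-refl; ↭-reflexive; ↭-trans; swap)

oddProduct : ℤ → ℤ → ℤ
oddProduct b c = (+ 2 * b + + 1) * (+ 2 * c + + 1)

reflect : ℤ → ℤ
reflect i = - i - + 1

reflect-involutive : ∀ i → reflect (reflect i) ≡ i
reflect-involutive = identity
  where
  identity : ∀ i → - (- i - + 1) - + 1 ≡ i
  identity = solve-∀

reflect-antitone : ∀ {i j} → i ≤ j → reflect j ≤ reflect i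
reflect-antitone i≤j = +-monoˡ-≤ (- + 1) (neg-mono-≤ i≤j)

reflect-nonNeg : ∀ {i} → i < + 0 → + 0 ≤ reflect i
reflect-nonNeg { -[1+ n ]} _         = +≤+ z≤n
reflect-nonNeg {+ n}      (+<+ ())

reflect-neg : ∀ {i} → ¬ (+ 0 ≤ i) → + 0 ≤ reflect i
reflect-neg 0≰i = reflect-nonNeg (≰⇒> 0≰i)

+-nonNeg : ∀ {i j} → + 0 ≤ i → + 0 ≤ j → + 0 ≤ i + j
+-nonNeg (+≤+ _) (+≤+ _) = +≤+ z≤n

*-nonNeg : ∀ {i j} → + 0 ≤ i → + 0 ≤ j → + 0 ≤ i * j
*-nonNeg {+ m} {j} _ 0≤j = subst (_≤ + m * j) (*-zeroʳ (+ m)) (*-monoˡ-≤-nonNeg (+ m) 0≤j)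

i*[i+1]-nonNeg : ∀ i → + 0 ≤ i * (i + + 1)
i*[i+1]-nonNeg (+ 0)         = +≤+ z≤n
i*[i+1]-nonNeg (+ (suc n))   = +≤+ z≤n
i*[i+1]-nonNeg -[1+ 0 ]      = +≤+ z≤n
i*[i+1]-nonNeg -[1+ suc n ]  = +≤+ z≤n

sqSum-nonNeg : ∀ xs → + 0 ≤ sqSum xs
sqSum-nonNeg []       = +≤+ z≤n
sqSum-nonNeg (x ∷ xs) = +-nonNeg (square-nonNeg x) (sqSum-nonNeg xs)
  where
  square-nonNeg : ∀ i → + 0 ≤ i * i
  square-nonNeg (+ 0)       = +≤+ z≤n
  square-nonNeg (+ (suc n)) = +≤+ z≤n
  square-nonNeg -[1+ n ]    = +≤+ z≤n

pairSum-double : ∀ xs → + 2 * pairSum xs ≡ sumℤ xs * sumℤ xs - sqSum xs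
pairSum-double []       = refl
pairSum-double (x ∷ xs) = begin
  + 2 * (x * S + pairSum xs)     ≡⟨ *-distribˡ-+ (+ 2) (x * S) (pairSum xs) ⟩
  + 2 * (x * S) + + 2 * pairSum xs ≡⟨ cong (_+_ (+ 2 * (x * S))) (pairSum-double xs) ⟩
  + 2 * (x * S) + (S * S - Q)    ≡⟨ expand x S Q ⟩
  (x + S) * (x + S) - (x * x + Q) ∎
  where
  open ≡-Reasoning
  S Q : ℤ
  S = sumℤ xs
  Q = sqSum xs
  expand : ∀ x S Q → + 2 * (x * S) + (S * S - Q) ≡ (x + S) * (x + S) - (x * x + Q)
  expand = solve-∀

F-via-sums : ∀ xs → F xs ≡ + 2 * sqSum xs - sumℤ xs * sumℤ xs - sumℤ xs
F-via-sums xs = begin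
  T * T - T - + 4 * pairSum xs          ≡⟨ cong (λ q → T * T - T - q) (*-assoc (+ 2) (+ 2) (pairSum xs)) ⟩
  T * T - T - + 2 * (+ 2 * pairSum xs)  ≡⟨ cong (λ q → T * T - T - + 2 * q) (pairSum-double xs) ⟩
  T * T - T - + 2 * (T * T - sqSum xs)  ≡⟨ collect T (sqSum xs) ⟩
  + 2 * sqSum xs - T * T - T             ∎
  where
  open ≡-Reasoning
  T : ℤ
  T = sumℤ xs
  collect : ∀ T Q → T * T - T - + 2 * (T * T - Q) ≡ + 2 * Q - T * T - T
  collect = solve-∀

F-tuple₁ : ∀ {k} (a : Vec ℤ k) m b c → F (tuple₁ a m b c) ≡ J a m - oddProduct b c
F-tuple₁ a m b c = trans (F-via-sums (tuple₁ a m b c)) (identity m b c (s a) (norm2 a))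
  where
  identity : ∀ m b c S Q →
    + 2 * ((b - S) * (b - S) + ((c - S) * (c - S) + ((b + c + + 1 - S + m) * (b + c + + 1 - S + m) + Q)))
      - (b - S + (c - S + (b + c + + 1 - S + m + S))) * (b - S + (c - S + (b + c + + 1 - S + m + S)))
      - (b - S + (c - S + (b + c + + 1 - S + m + S)))
    ≡ m * m + m + + 1 + + 2 * (S * S + S + Q) - (+ 2 * b + + 1) * (+ 2 * c + + 1)
  identity = solve-∀

J-reflect : ∀ {k} (a : Vec ℤ k) m → J a (reflect m) ≡ J a m
J-reflect a m = cong (λ t → t + + 1 + + 2 * (s a * s a + s a + norm2 a)) (identity m)
  where
  identity : ∀ m → (- m - + 1) * (- m - + 1) + (- m - + 1) ≡ m * m + m
  identity = solve-∀

oddProduct-reflect : ∀ b c → oddProduct (reflect c) (reflect b) ≡ oddProduct b c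
oddProduct-reflect = identity
  where
  identity : ∀ b c → (+ 2 * (- c - + 1) + + 1) * (+ 2 * (- b - + 1) + + 1) ≡ (+ 2 * b + + 1) * (+ 2 * c + + 1)
  identity = solve-∀

oddProduct-reflectˡ : ∀ b c → oddProduct b c ≡ - oddProduct (reflect b) c
oddProduct-reflectˡ = identity
  where
  identity : ∀ b c → (+ 2 * b + + 1) * (+ 2 * c + + 1) ≡ - ((+ 2 * (- b - + 1) + + 1) * (+ 2 * c + + 1))
  identity = solve-∀

tuple₂≡tuple₁ : ∀ {k} (a : Vec ℤ k) m b c → tuple₂ a m b c ≡ tuple₁ a (reflect m) b c
tuple₂≡tuple₁ a m b c = cong (λ z → b - s a ∷ c - s a ∷ z ∷ toList a) (identity m b c (s a))
  where
  identity : ∀ m b c S → b + c - S - m ≡ b + c + + 1 - S + (- m - + 1)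
  identity = solve-∀

tuple₃≡tuple₁ : ∀ {k} (a : Vec ℤ k) m b c → tuple₃ a m b c ≡ tuple₁ a m (reflect c) (reflect b)
tuple₃≡tuple₁ a m b c =
  cong₂ _∷_ (shift c S) (cong₂ _∷_ (shift b S) (cong (_∷ toList a) (identity m b c S)))
  where
  S : ℤ
  S = s a
  shift : ∀ i S → - (i + + 1) - S ≡ - i - + 1 - S
  shift = solve-∀
  identity : ∀ m b c S → - (b + c + S + + 1) + m ≡ (- c - + 1) + (- b - + 1) + + 1 - S + m
  identity = solve-∀

tuple₄≡tuple₃ : ∀ {k} (a : Vec ℤ k) m b c → tuple₄ a m b c ≡ tuple₃ a (reflect m) b c
tuple₄≡tuple₃ a m b c = cong (λ z → - (c + + 1) - s a ∷ - (b + + 1) - s a ∷ z ∷ toList a) (identity m b c (s a))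
  where
  identity : ∀ m b c S → - (b + c + S + + 2) - m ≡ - (b + c + S + + 1) + (- m - + 1)
  identity = solve-∀

tuple₁-solves : ∀ {k} (a : Vec ℤ k) m b c → J a m ≡ oddProduct b c → F (tuple₁ a m b c) ≡ + 0
tuple₁-solves a m b c J≡ = trans (F-tuple₁ a m b c) (i≡j⇒i-j≡0 J≡)

tuple₁-solution : ∀ {k} (a : Vec ℤ k) m b c → F (tuple₁ a m b c) ≡ + 0 → J a m ≡ oddProduct b c
tuple₁-solution a m b c F≡0 = i-j≡0⇒i≡j (J a m) (oddProduct b c) (trans (sym (F-tuple₁ a m b c)) F≡0)

tuples-solve : ∀ {k} (a : Vec ℤ k) m b c → J a m ≡ oddProduct b c →
  (F (tuple₁ a m b c) ≡ + 0) × (F (tuple₂ a m b c) ≡ + 0)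
  × (F (tuple₃ a m b c) ≡ + 0) × (F (tuple₄ a m b c) ≡ + 0)
tuples-solve a m b c J≡ =
    tuple₁-solves a m b c J≡
  , trans (cong F (tuple₂≡tuple₁ a m b c)) (tuple₁-solves a (reflect m) b c (trans (J-reflect a m) J≡))
  , trans (cong F (tuple₃≡tuple₁ a m b c)) (tuple₁-solves a m (reflect c) (reflect b) J≡ʳ)
  , trans (cong F (trans (tuple₄≡tuple₃ a m b c) (tuple₃≡tuple₁ a (reflect m) b c)))
          (tuple₁-solves a (reflect m) (reflect c) (reflect b) (trans (J-reflect a m) J≡ʳ))
  where
  J≡ʳ : J a m ≡ oddProduct (reflect c) (reflect b)
  J≡ʳ = trans J≡ (sym (oddProduct-reflect b c))

oddProduct-nonNeg : ∀ {b c} → + 0 ≤ b → + 0 ≤ c → + 0 ≤ oddProduct b c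
oddProduct-nonNeg {b} {c} 0≤b 0≤c = *-nonNeg {+ 2 * b + + 1} {+ 2 * c + + 1} (odd 0≤b) (odd 0≤c)
  where
  odd : ∀ {i} → + 0 ≤ i → + 0 ≤ + 2 * i + + 1
  odd {i} 0≤i = +-nonNeg {+ 2 * i} (*-nonNeg {+ 2} (+≤+ z≤n) 0≤i) (+≤+ z≤n)

oddProduct-nonPos : ∀ {b c} → b < + 0 → + 0 ≤ c → oddProduct b c ≤ + 0
oddProduct-nonPos {b} {c} b<0 0≤c =
  subst (_≤ + 0) (sym (oddProduct-reflectˡ b c)) (neg-mono-≤ (oddProduct-nonNeg (reflect-nonNeg b<0) 0≤c))

J-positive : ∀ {k} (a : Vec ℤ k) m → + 0 < J a m
J-positive a m = subst (+ 0 <_) (sym (identity m (s a) (norm2 a)))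
  (1+nonNeg-pos (+-nonNeg (i*[i+1]-nonNeg m) (+-nonNeg N-nonNeg N-nonNeg)))
  where
  identity : ∀ m S Q → m * m + m + + 1 + + 2 * (S * S + S + Q)
                     ≡ + 1 + (m * (m + + 1) + ((S * (S + + 1) + Q) + (S * (S + + 1) + Q)))
  identity = solve-∀
  N-nonNeg : + 0 ≤ s a * (s a + + 1) + norm2 a
  N-nonNeg = +-nonNeg (i*[i+1]-nonNeg (s a)) (sqSum-nonNeg (toList a))
  1+nonNeg-pos : ∀ {i} → + 0 ≤ i → + 0 < + 1 + i
  1+nonNeg-pos (+≤+ _) = +<+ (s≤s z≤n)

J≢oddProduct-of-mixed-signs : ∀ {k} (a : Vec ℤ k) m {b c} → b < + 0 → + 0 ≤ c → J a m ≢ oddProduct b c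
J≢oddProduct-of-mixed-signs a m b<0 0≤c J≡ =
  <⇒≱ (J-positive a m) (subst (_≤ + 0) (sym J≡) (oddProduct-nonPos b<0 0≤c))

InStandardForm : ℕ → List ℤ → Set
InStandardForm k xs = ∃[ a ] ∃[ m ] ∃[ b ] ∃[ c ] (Admissible {k} a m b c
  × (xs ↭ tuple₁ a m b c ⊎ xs ↭ tuple₂ a m b c ⊎ xs ↭ tuple₃ a m b c ⊎ xs ↭ tuple₄ a m b c))

InStandardForm-↭ : ∀ {k xs ys} → xs ↭ ys → InStandardForm k ys → InStandardForm k xs
InStandardForm-↭ xs↭ys (a , m , b , c , adm , ys↭) =
  a , m , b , c , adm , Sum.map prepend (Sum.map prepend (Sum.map prepend prepend)) ys↭
  where
  prepend : ∀ {zs} → _ ↭ zs → _ ↭ zs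
  prepend = ↭-trans xs↭ys

classify-nonNeg : ∀ {k} (a : Vec ℤ k) m {b c} → + 0 ≤ b → b ≤ c → J a m ≡ oddProduct b c →
  InStandardForm k (tuple₁ a m b c)
classify-nonNeg {k} a m {b} {c} 0≤b b≤c J≡ = by-sign (+ 0 ≤? m)
  where
  tuple₂-form : tuple₂ a (reflect m) b c ≡ tuple₁ a m b c
  tuple₂-form = trans (tuple₂≡tuple₁ a (reflect m) b c) (cong (λ m′ → tuple₁ a m′ b c) (reflect-involutive m))
  by-sign : Dec (+ 0 ≤ m) → InStandardForm k (tuple₁ a m b c)
  by-sign (yes 0≤m) = a , m , b , c , (0≤m , 0≤b , b≤c , J≡) , inj₁ ↭-refl
  by-sign (no 0≰m)  = a , reflect m , b , c , (reflect-neg 0≰m , 0≤b , b≤c , trans (J-reflect a m) J≡)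
                    , inj₂ (inj₁ (↭-reflexive (sym tuple₂-form)))

classify-neg : ∀ {k} (a : Vec ℤ k) m {b c} → c < + 0 → b ≤ c → J a m ≡ oddProduct b c →
  InStandardForm k (tuple₁ a m b c)
classify-neg {k} a m {b} {c} c<0 b≤c J≡ = by-sign (+ 0 ≤? m)
  where
  B C : ℤ
  B = reflect c
  C = reflect b
  J≡′ : J a m ≡ oddProduct B C
  J≡′ = trans J≡ (sym (oddProduct-reflect b c))
  tuple₃-form : tuple₃ a m B C ≡ tuple₁ a m b c
  tuple₃-form = trans (tuple₃≡tuple₁ a m B C) (cong₂ (tuple₁ a m) (reflect-involutive b) (reflect-involutive c))
  tuple₄-form : tuple₄ a (reflect m) B C ≡ tuple₁ a m b c
  tuple₄-form = trans (tuple₄≡tuple₃ a (reflect m) B C)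
                      (trans (cong (λ m′ → tuple₃ a m′ B C) (reflect-involutive m)) tuple₃-form)
  by-sign : Dec (+ 0 ≤ m) → InStandardForm k (tuple₁ a m b c)
  by-sign (yes 0≤m) = a , m , B , C , (0≤m , reflect-nonNeg c<0 , reflect-antitone b≤c , J≡′)
                    , inj₂ (inj₂ (inj₁ (↭-reflexive (sym tuple₃-form))))
  by-sign (no 0≰m)  = a , reflect m , B , C
                    , (reflect-neg 0≰m , reflect-nonNeg c<0 , reflect-antitone b≤c , trans (J-reflect a m) J≡′)
                    , inj₂ (inj₂ (inj₂ (↭-reflexive (sym tuple₄-form))))

classify-tuple₁ : ∀ {k} (a : Vec ℤ k) m {b c} → b ≤ c → J a m ≡ oddProduct b c →
  InStandardForm k (tuple₁ a m b c)
classify-tuple₁ a m {b} {c} b≤c J≡ with + 0 ≤? b | + 0 ≤? c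
... | yes 0≤b | _       = classify-nonNeg a m 0≤b b≤c J≡
... | no 0≰b  | yes 0≤c = ⊥-elim (J≢oddProduct-of-mixed-signs a m (≰⇒> 0≰b) 0≤c J≡)
... | no _    | no 0≰c  = classify-neg a m (≰⇒> 0≰c) b≤c J≡

cons₃≡tuple₁ : ∀ {k} x y z (a : Vec ℤ k) →
  x ∷ y ∷ z ∷ toList a ≡ tuple₁ a (z - x - y - s a - + 1) (x + s a) (y + s a)
cons₃≡tuple₁ x y z a = cong₂ _∷_ (cancel x S) (cong₂ _∷_ (cancel y S) (cong (_∷ toList a) (identity x y z S)))
  where
  S : ℤ
  S = s a
  cancel : ∀ x S → x ≡ x + S - S
  cancel = solve-∀
  identity : ∀ x y z S → z ≡ x + S + (y + S) + + 1 - S + (z - x - y - S - + 1)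
  identity = solve-∀

F-swap : ∀ x y l → F (y ∷ x ∷ l) ≡ F (x ∷ y ∷ l)
F-swap x y l = trans (F-via-sums (y ∷ x ∷ l)) (trans (identity x y (sumℤ l) (sqSum l)) (sym (F-via-sums (x ∷ y ∷ l))))
  where
  identity : ∀ x y S Q →
    + 2 * (y * y + (x * x + Q)) - (y + (x + S)) * (y + (x + S)) - (y + (x + S))
    ≡ + 2 * (x * x + (y * y + Q)) - (x + (y + S)) * (x + (y + S)) - (x + (y + S))
  identity = solve-∀

classify-ordered : ∀ {k} x y z (a : Vec ℤ k) → x ≤ y → F (x ∷ y ∷ z ∷ toList a) ≡ + 0 →
  InStandardForm k (x ∷ y ∷ z ∷ toList a)
classify-ordered {k} x y z a x≤y F≡0 =
  subst (InStandardForm k) (sym form)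
    (classify-tuple₁ a m (+-monoˡ-≤ (s a) x≤y)
      (tuple₁-solution a m (x + s a) (y + s a) (trans (cong F (sym form)) F≡0)))
  where
  m : ℤ
  m = z - x - y - s a - + 1
  form : x ∷ y ∷ z ∷ toList a ≡ tuple₁ a m (x + s a) (y + s a)
  form = cons₃≡tuple₁ x y z a

classify : ∀ {k} x y z (a : Vec ℤ k) → F (x ∷ y ∷ z ∷ toList a) ≡ + 0 → InStandardForm k (x ∷ y ∷ z ∷ toList a)
classify x y z a F≡0 with x ≤? y
... | yes x≤y = classify-ordered x y z a x≤y F≡0
... | no x≰y  = InStandardForm-↭ (swap x y ↭-refl)
                  (classify-ordered y x z a (<⇒≤ (≰⇒> x≰y)) (trans (F-swap x y (z ∷ toList a)) F≡0))

theorem3p2 : (n : ℕ) → 3 Data.Nat.≤ n →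
    ((a : Vec ℤ (n ∸ 3)) (m b c : ℤ) → Admissible a m b c →
       (F (tuple₁ a m b c) ≡ + 0) × (F (tuple₂ a m b c) ≡ + 0)
       × (F (tuple₃ a m b c) ≡ + 0) × (F (tuple₄ a m b c) ≡ + 0))
    × ((x : Vec ℤ n) → F (toList x) ≡ + 0 →
       ∃[ a ] ∃[ m ] ∃[ b ] ∃[ c ] (Admissible {n ∸ 3} a m b c
         × (toList x ↭ tuple₁ a m b c ⊎ toList x ↭ tuple₂ a m b c
            ⊎ toList x ↭ tuple₃ a m b c ⊎ toList x ↭ tuple₄ a m b c)))
theorem3p2 (suc (suc (suc k))) (s≤s (s≤s (s≤s z≤n))) =
    (λ { a m b c (_ , _ , _ , J≡) → tuples-solve a m b c J≡ })
  , (λ { (x ∷ y ∷ z ∷ a) → classify x y z a })
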